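{- Let $V$ be a finite set of size $v$ and let $(\mathfrak{P}_0,\ldots,\mathfrak{P}_v)$ be a tactical sequence of partitions on $V$. Let $x,y,z\in\{0,\ldots,v\}$. For $X\in\binom{V}{x}$ let $[X]$ denote the part of $\mathfrak{P}_x$ containing $X$. (a) If $y\leq\min(x,z)$, then for all $X\in\binom{V}{x}$ and $\mathcal{Z}\in\mathfrak{P}_z$, \[\big((K^{(yx)})^\top R^{(yz)}\big)_{[X],\mathcal{Z}}=\sum_{Z\in\mathcal{Z}}\binom{\#(X\cap Z)}{y}.\] (b) If $\max(x,z)\leq y$, then for all $X\in\binom{V}{x}$ and $\mathcal{Z}\in\mathfrak{P}_z$, \[\big(R^{(xy)}(K^{(zy)})^\top\big)_{[X],\mathcal{Z}}=\sum_{Z\in\mathcal{Z}}\binom{v-\#(X\cup Z)}{v-y}.\]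
   Context: For $x\in\{0,\ldots,v\}$, $\binom{V}{x}$ denotes the set of $x$-subsets of $V$, and $\mathfrak{P}_x$ is a partition of $\binom{V}{x}$. The sequence $(\mathfrak{P}_0,\ldots,\mathfrak{P}_v)$ is called a tactical sequence of partitions on $V$ if for all $x\leq y$ and all parts $\mathcal{X}\in\mathfrak{P}_x$, $\mathcal{Y}\in\mathfrak{P}_y$, the number $\#\{Y\in\mathcal{Y}\mid X\subseteq Y\}$ is the same for every $X\in\mathcal{X}$, and the number $\#\{X\in\mathcal{X}\mid X\subseteq Y\}$ is the same for every $Y\in\mathcal{Y}$. These common values define matrices $R^{(xy)},K^{(xy)}\in\mathbb{Z}^{\mathfrak{P}_x\times\mathfrak{P}_y}$ (for $x\le y$) with $R^{(xy)}_{\mathcal{X},\mathcal{Y}}=\#\{Y\in\mathcal{Y}\mid X\subseteq Y\}$ (any $X\in\mathcal{X}$) and $K^{(xy)}_{\mathcal{X},\mathcal{Y}}=\#\{X\in\mathcal{X}\mid X\subseteq Y\}$ (any $Y\in\mathcal{Y}$). -}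

module Defs where

open import Data.Nat using (ℕ; zero; suc; _+_; _*_; _∸_; _≤_)
open import Data.Nat.Properties using (_≟_)
open import Data.Nat.Combinatorics using (_C_)
open import Data.Fin using (Fin)
import Data.Fin.Properties as FinP
open import Data.Fin.Subset using (Subset; inside; outside; _⊆_; _∩_; _∪_; ∣_∣)
open import Data.Fin.Subset.Properties using (_⊆?_)
open import Data.List using (List; []; _∷_; _++_; map; filter; length; allFin)
open import Data.Nat.ListAction using (sum)
open import Data.Vec using (_∷_; [])
open import Data.Product using (_×_)
open import Relation.Nullary.Decidable using (_×-dec_)
open import Relation.Binary.PropositionalEquality using (_≡_)

-- The ground set V is Fin v; subsets of V are Subset v.
-- All 2^n subsets of Fin n, listed without repetition.
allSubsets : (n : ℕ) → List (Subset n)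
allSubsets zero = [] ∷ []
allSubsets (suc n) = map (outside ∷_) (allSubsets n) ++ map (inside ∷_) (allSubsets n)

-- A family of partitions 𝔓_x of the x-subsets of Fin v (for x ≤ v).
-- Parts of 𝔓_x are indexed by Fin (nParts x); label x X is the index of
-- the part [X] containing the x-subset X (meaningless for ∣X∣ ≢ x).
-- Parts are nonempty: rep x _ i is an x-subset lying in part i.
record PartitionSeq (v : ℕ) : Set where
  field
    nParts    : ℕ → ℕ
    label     : (x : ℕ) → Subset v → Fin (nParts x)
    rep       : (x : ℕ) → x ≤ v → Fin (nParts x) → Subset v
    rep-size  : (x : ℕ) (x≤v : x ≤ v) (i : Fin (nParts x)) → ∣ rep x x≤v i ∣ ≡ x
    rep-label : (x : ℕ) (x≤v : x ≤ v) (i : Fin (nParts x)) → label x (rep x x≤v i) ≡ i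

module _ {v : ℕ} (P : PartitionSeq v) where
  open PartitionSeq P

  countUp : (y : ℕ) → Subset v → Fin (nParts y) → ℕ
  countUp y X j = length (filter (λ Y → (∣ Y ∣ ≟ y) ×-dec ((label y Y FinP.≟ j) ×-dec (X ⊆? Y))) (allSubsets v))

  countDown : (x : ℕ) → Fin (nParts x) → Subset v → ℕ
  countDown x i Y = length (filter (λ X → (∣ X ∣ ≟ x) ×-dec ((label x X FinP.≟ i) ×-dec (X ⊆? Y))) (allSubsets v))

  IsTactical : Set
  IsTactical = (x y : ℕ) → x ≤ y → y ≤ v →
      ((X X′ : Subset v) → ∣ X ∣ ≡ x → ∣ X′ ∣ ≡ x → label x X ≡ label x X′ →
         (j : Fin (nParts y)) → countUp y X j ≡ countUp y X′ j)
    × ((Y Y′ : Subset v) → ∣ Y ∣ ≡ y → ∣ Y′ ∣ ≡ y → label y Y ≡ label y Y′ →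
         (i : Fin (nParts x)) → countDown x i Y ≡ countDown x i Y′)

  -- R^(xy)_{i,j}, K^(xy)_{i,j}, computed on a representative of the relevant part
  -- (well-defined for tactical sequences)
  R : (x y : ℕ) → y ≤ v → x ≤ v → Fin (nParts x) → Fin (nParts y) → ℕ
  R x y _ x≤v i j = countUp y (rep x x≤v i) j

  K : (x y : ℕ) → y ≤ v → Fin (nParts x) → Fin (nParts y) → ℕ
  K x y y≤v i j = countDown x i (rep y y≤v j)

  sumOverPart : (z : ℕ) → Fin (nParts z) → (Subset v → ℕ) → ℕ
  sumOverPart z j f = sum (map f (filter (λ Z → (∣ Z ∣ ≟ z) ×-dec (label z Z FinP.≟ j)) (allSubsets v)))

  KtR : (x y z : ℕ) → x ≤ v → y ≤ v → z ≤ v → Fin (nParts x) → Fin (nParts z) → ℕ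
  KtR x y z x≤v y≤v z≤v i j = sum (map (λ k → K y x x≤v k i * R y z z≤v y≤v k j) (allFin (nParts y)))

  RKt : (x y z : ℕ) → x ≤ v → y ≤ v → Fin (nParts x) → Fin (nParts z) → ℕ
  RKt x y z x≤v y≤v i j = sum (map (λ k → R x y y≤v x≤v i k * K z y y≤v j k) (allFin (nParts y)))

-- Both identities are double counts of chains. Expanding the matrix product, the
-- entry ((K^(yx))ᵀ R^(yz))_{[X],j} counts, part by part of 𝔓_y, the y-sets Y ⊆ X
-- weighted by the number of Z in part j above a representative of Y's part;
-- tacticality lets us replace the representative by Y itself, so the entry counts
-- the pairs (Y, Z) with Y ⊆ X ∩ Z, ∣Y∣ = y and Z in part j. Summing over Y first,
-- the y-subsets of X ∩ Z number ∣X ∩ Z∣ C y. Part (b) is the same count of pairs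
-- with X ∪ Z ⊆ Y; passing to complements, the y-supersets of X ∪ Z number
-- (v ∸ ∣X ∪ Z∣) C (v ∸ y).
module Submission where

open import Defs
open import Data.Bool using (true; false; if_then_else_)
open import Data.Nat using (ℕ; zero; suc; _+_; _*_; _∸_; _≤_; _⊓_; _⊔_)
open import Data.Nat.Properties
  using (_≟_; +-comm; +-assoc; +-identityʳ; *-zeroʳ; *-identityˡ; *-assoc; *-distribˡ-+;
         *-comm; m∸[m∸n]≡n; ≤-trans; m⊓n≤m; m⊓n≤n; m≤m⊔n; m≤n⊔m; *-commutativeSemigroup;
         +-commutativeSemigroup)
open import Algebra.Properties.CommutativeSemigroup *-commutativeSemigroup using () renaming (x∙yz≈y∙xz to *-left-comm)
open import Algebra.Properties.CommutativeSemigroup +-commutativeSemigroup using () renaming (x∙yz≈y∙xz to +-left-comm)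
open import Data.Nat.Combinatorics using (_C_; nCk+nC[k+1]≡[n+1]C[k+1])
open import Data.Fin using (Fin)
import Data.Fin.Properties as FinP
open import Data.Fin.Subset using (Subset; inside; outside; _⊆_; _∩_; _∪_; ∣_∣; ∁)
open import Data.Fin.Subset.Properties
  using (_⊆?_; ∣∁p∣≡n∸∣p∣; ∣p∣≤n; x∈p⇒x∉∁p; x∉p⇒x∈∁p; x∈p∩q⁺; p∩q⊆p; p∩q⊆q;
         x∈p∪q⁻; p⊆p∪q; q⊆p∪q)
open import Data.List using (List; []; _∷_; _++_; map; filter; length; allFin)
open import Data.List.Properties using (map-tabulate)
open import Data.Nat.ListAction using (sum)
open import Data.Vec using (_∷_; [])
open import Data.Product using (_×_; _,_; proj₁; proj₂)
open import Data.Sum using ([_,_]′)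
open import Function using (_∘_)
open import Function.Bundles using (_⇔_; mk⇔)
open import Relation.Nullary using (Dec; does; yes; no)
open import Relation.Nullary.Decidable using (_×-dec_; does-⇔)
open import Relation.Binary.PropositionalEquality
  using (_≡_; refl; sym; trans; cong; cong₂; module ≡-Reasoning)

-- 𝟙 inspects only `does`, so it computes through _×-dec_, through _⊆?_ on cons cells
-- and through _≟_ on ℕ- and Fin-constructors; several proofs below rely on these reductions.
𝟙 : {P : Set} → Dec P → ℕ
𝟙 P? = if does P? then 1 else 0

𝟙-× : {P Q : Set} (P? : Dec P) (Q? : Dec Q) → 𝟙 (P? ×-dec Q?) ≡ 𝟙 P? * 𝟙 Q?
𝟙-× (yes _) Q? = sym (+-identityʳ (𝟙 Q?))
𝟙-× (no _)  Q? = refl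

𝟙-×-assoc : {P Q R : Set} (P? : Dec P) (Q? : Dec Q) (R? : Dec R) →
  𝟙 (P? ×-dec (Q? ×-dec R?)) ≡ 𝟙 (P? ×-dec Q?) * 𝟙 R?
𝟙-×-assoc (yes _) (yes _) R? = sym (+-identityʳ (𝟙 R?))
𝟙-×-assoc (yes _) (no _)  R? = refl
𝟙-×-assoc (no _)  Q?      R? = refl

𝟙-cong : {P Q : Set} → P ⇔ Q → (P? : Dec P) (Q? : Dec Q) → 𝟙 P? ≡ 𝟙 Q?
𝟙-cong P⇔Q P? Q? = cong (λ b → if b then 1 else 0) (does-⇔ P⇔Q P? Q?)

∑ : {A : Set} → List A → (A → ℕ) → ℕ
∑ L f = sum (map f L)

infix 5 ∑
syntax ∑ L (λ a → e) = ∑[ a ∈ L ] e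

∑-cong : {A : Set} (L : List A) {f g : A → ℕ} → (∀ a → f a ≡ g a) → ∑ L f ≡ ∑ L g
∑-cong []      f≗g = refl
∑-cong (a ∷ L) f≗g = cong₂ _+_ (f≗g a) (∑-cong L f≗g)

∑-++ : {A : Set} (L M : List A) (f : A → ℕ) → ∑ (L ++ M) f ≡ ∑ L f + ∑ M f
∑-++ []      M f = refl
∑-++ (a ∷ L) M f = trans (cong (f a +_) (∑-++ L M f)) (sym (+-assoc (f a) _ _))

∑-map : {A B : Set} (h : B → A) (L : List B) (f : A → ℕ) → ∑ (map h L) f ≡ ∑ L (f ∘ h)
∑-map h []      f = refl
∑-map h (b ∷ L) f = cong (f (h b) +_) (∑-map h L f)

∑-zero : {A : Set} (L : List A) → ∑[ a ∈ L ] 0 ≡ 0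
∑-zero []      = refl
∑-zero (a ∷ L) = ∑-zero L

∑-+ : {A : Set} (L : List A) (f g : A → ℕ) → ∑[ a ∈ L ] (f a + g a) ≡ ∑ L f + ∑ L g
∑-+ []      f g = refl
∑-+ (a ∷ L) f g = begin
  f a + g a + ∑ L (λ a → f a + g a)  ≡⟨ cong (f a + g a +_) (∑-+ L f g) ⟩
  f a + g a + (∑ L f + ∑ L g)       ≡⟨ +-assoc (f a) (g a) _ ⟩
  f a + (g a + (∑ L f + ∑ L g))     ≡⟨ cong (f a +_) (+-left-comm (g a) (∑ L f) (∑ L g)) ⟩
  f a + (∑ L f + (g a + ∑ L g))     ≡⟨ +-assoc (f a) _ _ ⟨
  f a + ∑ L f + (g a + ∑ L g)       ∎
  where open ≡-Reasoning

*-distribˡ-∑ : {A : Set} (c : ℕ) (L : List A) (f : A → ℕ) → c * ∑ L f ≡ ∑[ a ∈ L ] c * f a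
*-distribˡ-∑ c []      f = *-zeroʳ c
*-distribˡ-∑ c (a ∷ L) f = trans (*-distribˡ-+ c (f a) _) (cong (c * f a +_) (*-distribˡ-∑ c L f))

*-distribʳ-∑ : {A : Set} (c : ℕ) (L : List A) (f : A → ℕ) → ∑ L f * c ≡ ∑[ a ∈ L ] f a * c
*-distribʳ-∑ c L f =
  trans (*-comm (∑ L f) c) (trans (*-distribˡ-∑ c L f) (∑-cong L (λ a → *-comm c (f a))))

∑-comm : {A B : Set} (L : List A) (M : List B) (f : A → B → ℕ) →
  ∑[ a ∈ L ] ∑ M (f a) ≡ ∑[ b ∈ M ] ∑[ a ∈ L ] f a b
∑-comm []      M f = sym (∑-zero M)
∑-comm (a ∷ L) M f =
  trans (cong (∑ M (f a) +_) (∑-comm L M f)) (sym (∑-+ M (f a) (λ b → ∑[ a ∈ L ] f a b)))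

∑-interchange : {A B : Set} (L : List A) (M : List B) (f : A → ℕ) (g : B → ℕ) (h : A → B → ℕ) →
  ∑[ a ∈ L ] f a * (∑[ b ∈ M ] g b * h a b) ≡ ∑[ b ∈ M ] g b * (∑[ a ∈ L ] f a * h a b)
∑-interchange L M f g h = begin
  ∑[ a ∈ L ] f a * (∑[ b ∈ M ] g b * h a b)     ≡⟨ ∑-cong L (λ a → *-distribˡ-∑ (f a) M _) ⟩
  ∑[ a ∈ L ] ∑[ b ∈ M ] f a * (g b * h a b)   ≡⟨ ∑-comm L M _ ⟩
  ∑[ b ∈ M ] ∑[ a ∈ L ] f a * (g b * h a b)   ≡⟨ ∑-cong M (λ b → ∑-cong L (λ a → *-left-comm (f a) (g b) _)) ⟩
  ∑[ b ∈ M ] ∑[ a ∈ L ] g b * (f a * h a b)   ≡⟨ ∑-cong M (λ b → *-distribˡ-∑ (g b) L _) ⟨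
  ∑[ b ∈ M ] g b * (∑[ a ∈ L ] f a * h a b)     ∎
  where open ≡-Reasoning

length-filter≡∑𝟙 : {A : Set} {P : A → Set} (P? : ∀ a → Dec (P a)) (L : List A) →
  length (filter P? L) ≡ ∑[ a ∈ L ] 𝟙 (P? a)
length-filter≡∑𝟙 P? []      = refl
length-filter≡∑𝟙 P? (a ∷ L) with does (P? a)
... | true  = cong suc (length-filter≡∑𝟙 P? L)
... | false = length-filter≡∑𝟙 P? L

∑-filter : {A : Set} {P : A → Set} (P? : ∀ a → Dec (P a)) (L : List A) (f : A → ℕ) →
  ∑ (filter P? L) f ≡ ∑[ a ∈ L ] 𝟙 (P? a) * f a
∑-filter P? []      f = refl
∑-filter P? (a ∷ L) f with does (P? a)
... | true  = cong₂ _+_ (sym (+-identityʳ (f a))) (∑-filter P? L f)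
... | false = ∑-filter P? L f

∑-allFin-suc : (n : ℕ) (f : Fin (suc n) → ℕ) →
  ∑ (allFin (suc n)) f ≡ f Fin.zero + (∑[ k ∈ allFin n ] f (Fin.suc k))
∑-allFin-suc n f = cong (f Fin.zero +_)
  (trans (cong (λ L → ∑ L f) (sym (map-tabulate (λ k → k) Fin.suc))) (∑-map Fin.suc (allFin n) f))

∑-allFin-𝟙≟ : {n : ℕ} (i : Fin n) (g : Fin n → ℕ) → ∑[ k ∈ allFin n ] 𝟙 (i FinP.≟ k) * g k ≡ g i
∑-allFin-𝟙≟ {suc n} Fin.zero g = begin
  ∑[ k ∈ allFin (suc n) ] 𝟙 (Fin.zero FinP.≟ k) * g k  ≡⟨ ∑-allFin-suc n _ ⟩
  g Fin.zero + 0 + (∑[ k ∈ allFin n ] 0)                 ≡⟨ cong₂ _+_ (+-identityʳ (g Fin.zero)) (∑-zero (allFin n)) ⟩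
  g Fin.zero + 0                                         ≡⟨ +-identityʳ (g Fin.zero) ⟩
  g Fin.zero                                             ∎
  where open ≡-Reasoning
∑-allFin-𝟙≟ {suc n} (Fin.suc i) g =
  trans (∑-allFin-suc n (λ k → 𝟙 (Fin.suc i FinP.≟ k) * g k)) (∑-allFin-𝟙≟ i (g ∘ Fin.suc))

∑-allSubsets-suc : (n : ℕ) (f : Subset (suc n) → ℕ) →
  ∑ (allSubsets (suc n)) f ≡ (∑[ Y ∈ allSubsets n ] f (outside ∷ Y)) + (∑[ Y ∈ allSubsets n ] f (inside ∷ Y))
∑-allSubsets-suc n f =
  trans (∑-++ (map (outside ∷_) 𝒫) _ f) (cong₂ _+_ (∑-map (outside ∷_) 𝒫 f) (∑-map (inside ∷_) 𝒫 f))
  where 𝒫 = allSubsets n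

∑-allSubsets-∁ : (n : ℕ) (f : Subset n → ℕ) → ∑ (allSubsets n) f ≡ ∑[ Y ∈ allSubsets n ] f (∁ Y)
∑-allSubsets-∁ zero    f = refl
∑-allSubsets-∁ (suc n) f = begin
  ∑ (allSubsets (suc n)) f
    ≡⟨ ∑-allSubsets-suc n f ⟩
  (∑[ Y ∈ 𝒫 ] f (outside ∷ Y)) + (∑[ Y ∈ 𝒫 ] f (inside ∷ Y))
    ≡⟨ cong₂ _+_ (∑-allSubsets-∁ n _) (∑-allSubsets-∁ n _) ⟩
  (∑[ Y ∈ 𝒫 ] f (outside ∷ ∁ Y)) + (∑[ Y ∈ 𝒫 ] f (inside ∷ ∁ Y))
    ≡⟨ +-comm (∑[ Y ∈ 𝒫 ] f (outside ∷ ∁ Y)) _ ⟩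
  (∑[ Y ∈ 𝒫 ] f (inside ∷ ∁ Y)) + (∑[ Y ∈ 𝒫 ] f (outside ∷ ∁ Y))
    ≡⟨ ∑-allSubsets-suc n (f ∘ ∁) ⟨
  ∑[ Y ∈ allSubsets (suc n) ] f (∁ Y)
    ∎
  where
  open ≡-Reasoning
  𝒫 = allSubsets n

∑-subsets-of-size : {n : ℕ} (B : Subset n) (y : ℕ) →
  ∑[ Y ∈ allSubsets n ] 𝟙 (∣ Y ∣ ≟ y) * 𝟙 (Y ⊆? B) ≡ ∣ B ∣ C y
∑-subsets-of-size []      zero    = refl
∑-subsets-of-size []      (suc y) = refl
∑-subsets-of-size {suc n} (b ∷ B) y = begin
  ∑[ Y ∈ allSubsets (suc n) ] 𝟙 (∣ Y ∣ ≟ y) * 𝟙 (Y ⊆? b ∷ B)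
    ≡⟨ ∑-allSubsets-suc n _ ⟩
  (∑[ Y ∈ 𝒫 ] 𝟙 (∣ Y ∣ ≟ y) * 𝟙 (Y ⊆? B)) + (∑[ Y ∈ 𝒫 ] 𝟙 (suc ∣ Y ∣ ≟ y) * 𝟙 (inside ∷ Y ⊆? b ∷ B))
    ≡⟨ cong (_+ (∑[ Y ∈ 𝒫 ] 𝟙 (suc ∣ Y ∣ ≟ y) * 𝟙 (inside ∷ Y ⊆? b ∷ B))) (∑-subsets-of-size B y) ⟩
  ∣ B ∣ C y + (∑[ Y ∈ 𝒫 ] 𝟙 (suc ∣ Y ∣ ≟ y) * 𝟙 (inside ∷ Y ⊆? b ∷ B))
    ≡⟨ pascal b y ⟩
  ∣ b ∷ B ∣ C y
    ∎
  where
  open ≡-Reasoning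
  𝒫 = allSubsets n
  no-inside : (y : ℕ) → ∣ B ∣ C y + (∑[ Y ∈ 𝒫 ] 0) ≡ ∣ B ∣ C y
  no-inside y = trans (cong (∣ B ∣ C y +_) (∑-zero 𝒫)) (+-identityʳ _)
  pascal : (b : _) (y : ℕ) →
    ∣ B ∣ C y + (∑[ Y ∈ 𝒫 ] 𝟙 (suc ∣ Y ∣ ≟ y) * 𝟙 (inside ∷ Y ⊆? b ∷ B)) ≡ ∣ b ∷ B ∣ C y
  pascal outside y = trans (cong (∣ B ∣ C y +_) (∑-cong 𝒫 (λ Y → *-zeroʳ (𝟙 (suc ∣ Y ∣ ≟ y))))) (no-inside y)
  pascal inside zero = no-inside zero
  pascal inside (suc y) = begin
    ∣ B ∣ C suc y + (∑[ Y ∈ 𝒫 ] 𝟙 (∣ Y ∣ ≟ y) * 𝟙 (Y ⊆? B))  ≡⟨ cong (∣ B ∣ C suc y +_) (∑-subsets-of-size B y) ⟩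
    ∣ B ∣ C suc y + ∣ B ∣ C y                              ≡⟨ +-comm (∣ B ∣ C suc y) _ ⟩
    ∣ B ∣ C y + ∣ B ∣ C suc y                              ≡⟨ nCk+nC[k+1]≡[n+1]C[k+1] ∣ B ∣ y ⟩
    suc ∣ B ∣ C suc y                                      ∎

∸-flip : {n a b : ℕ} → a ≤ n → n ∸ a ≡ b → a ≡ n ∸ b
∸-flip a≤n n∸a≡b = trans (sym (m∸[m∸n]≡n a≤n)) (cong (_ ∸_) n∸a≡b)

⊆∁-swap : {n : ℕ} {A Y : Subset n} → A ⊆ ∁ Y → Y ⊆ ∁ A
⊆∁-swap A⊆∁Y x∈Y = x∉p⇒x∈∁p (λ x∈A → x∈p⇒x∉∁p x∈Y (A⊆∁Y x∈A))

∑-supersets-of-size : {n y : ℕ} (A : Subset n) → y ≤ n →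
  ∑[ Y ∈ allSubsets n ] 𝟙 (∣ Y ∣ ≟ y) * 𝟙 (A ⊆? Y) ≡ (n ∸ ∣ A ∣) C (n ∸ y)
∑-supersets-of-size {n} {y} A y≤n = begin
  ∑[ Y ∈ allSubsets n ] 𝟙 (∣ Y ∣ ≟ y) * 𝟙 (A ⊆? Y)
    ≡⟨ ∑-allSubsets-∁ n _ ⟩
  ∑[ Y ∈ allSubsets n ] 𝟙 (∣ ∁ Y ∣ ≟ y) * 𝟙 (A ⊆? ∁ Y)
    ≡⟨ ∑-cong (allSubsets n) (λ Y → cong₂ _*_
         (𝟙-cong (size⇔ Y) (∣ ∁ Y ∣ ≟ y) (∣ Y ∣ ≟ n ∸ y)) (𝟙-cong swap⇔ (A ⊆? ∁ Y) (Y ⊆? ∁ A))) ⟩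
  ∑[ Y ∈ allSubsets n ] 𝟙 (∣ Y ∣ ≟ n ∸ y) * 𝟙 (Y ⊆? ∁ A)
    ≡⟨ ∑-subsets-of-size (∁ A) (n ∸ y) ⟩
  ∣ ∁ A ∣ C (n ∸ y)
    ≡⟨ cong (_C (n ∸ y)) (∣∁p∣≡n∸∣p∣ A) ⟩
  (n ∸ ∣ A ∣) C (n ∸ y)
    ∎
  where
  open ≡-Reasoning
  size⇔ : (Y : Subset n) → ∣ ∁ Y ∣ ≡ y ⇔ ∣ Y ∣ ≡ n ∸ y
  size⇔ Y rewrite ∣∁p∣≡n∸∣p∣ Y =
    mk⇔ (∸-flip (∣p∣≤n Y)) (λ ∣Y∣≡n∸y → sym (∸-flip y≤n (sym ∣Y∣≡n∸y)))
  swap⇔ : {Y : Subset n} → A ⊆ ∁ Y ⇔ Y ⊆ ∁ A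
  swap⇔ = mk⇔ ⊆∁-swap ⊆∁-swap

𝟙-⊆-∩ : {n : ℕ} (Y X Z : Subset n) → 𝟙 (Y ⊆? X) * 𝟙 (Y ⊆? Z) ≡ 𝟙 (Y ⊆? X ∩ Z)
𝟙-⊆-∩ Y X Z = trans (sym (𝟙-× (Y ⊆? X) (Y ⊆? Z))) (𝟙-cong ⊆-∩⇔ ((Y ⊆? X) ×-dec (Y ⊆? Z)) (Y ⊆? X ∩ Z))
  where
  ⊆-∩⇔ : (Y ⊆ X × Y ⊆ Z) ⇔ Y ⊆ X ∩ Z
  ⊆-∩⇔ = mk⇔ (λ (Y⊆X , Y⊆Z) {_} x∈Y → x∈p∩q⁺ (Y⊆X x∈Y , Y⊆Z x∈Y))
              (λ Y⊆X∩Z → (λ {_} x∈Y → p∩q⊆p X Z (Y⊆X∩Z x∈Y)) , (λ {_} x∈Y → p∩q⊆q X Z (Y⊆X∩Z x∈Y)))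

𝟙-∪-⊆ : {n : ℕ} (X Z Y : Subset n) → 𝟙 (X ⊆? Y) * 𝟙 (Z ⊆? Y) ≡ 𝟙 (X ∪ Z ⊆? Y)
𝟙-∪-⊆ X Z Y = trans (sym (𝟙-× (X ⊆? Y) (Z ⊆? Y))) (𝟙-cong ∪-⊆⇔ ((X ⊆? Y) ×-dec (Z ⊆? Y)) (X ∪ Z ⊆? Y))
  where
  ∪-⊆⇔ : (X ⊆ Y × Z ⊆ Y) ⇔ X ∪ Z ⊆ Y
  ∪-⊆⇔ = mk⇔ (λ (X⊆Y , Z⊆Y) {_} x∈X∪Z → [ (λ x∈X → X⊆Y x∈X) , (λ x∈Z → Z⊆Y x∈Z) ]′ (x∈p∪q⁻ X Z x∈X∪Z))
              (λ X∪Z⊆Y → (λ {_} x∈X → X∪Z⊆Y (p⊆p∪q Z x∈X)) , (λ {_} x∈Z → X∪Z⊆Y (q⊆p∪q X Z x∈Z)))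

∑-common-subsets-of-size : {n : ℕ} (X Z : Subset n) (y : ℕ) →
  ∑[ Y ∈ allSubsets n ] 𝟙 (∣ Y ∣ ≟ y) * 𝟙 (Y ⊆? X) * 𝟙 (Y ⊆? Z) ≡ ∣ X ∩ Z ∣ C y
∑-common-subsets-of-size {n} X Z y = trans
  (∑-cong (allSubsets n) (λ Y →
    trans (*-assoc (𝟙 (∣ Y ∣ ≟ y)) _ _) (cong (𝟙 (∣ Y ∣ ≟ y) *_) (𝟙-⊆-∩ Y X Z))))
  (∑-subsets-of-size (X ∩ Z) y)

∑-common-supersets-of-size : {n y : ℕ} (X Z : Subset n) → y ≤ n →
  ∑[ Y ∈ allSubsets n ] 𝟙 (∣ Y ∣ ≟ y) * 𝟙 (X ⊆? Y) * 𝟙 (Z ⊆? Y) ≡ (n ∸ ∣ X ∪ Z ∣) C (n ∸ y)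
∑-common-supersets-of-size {n} {y} X Z y≤n = trans
  (∑-cong (allSubsets n) (λ Y →
    trans (*-assoc (𝟙 (∣ Y ∣ ≟ y)) _ _) (cong (𝟙 (∣ Y ∣ ≟ y) *_) (𝟙-∪-⊆ X Z Y))))
  (∑-supersets-of-size (X ∪ Z) y≤n)

∑-fibres : {A : Set} {P : A → Set} {n : ℕ} (L : List A) (P? : ∀ a → Dec (P a)) (ℓ : A → Fin n)
  (w f : A → ℕ) (c : Fin n → ℕ) → (∀ a → P a → c (ℓ a) ≡ f a) →
  ∑[ k ∈ allFin n ] (∑[ a ∈ L ] 𝟙 (P? a ×-dec (ℓ a FinP.≟ k)) * w a) * c k
    ≡ ∑[ a ∈ L ] 𝟙 (P? a) * w a * f a
∑-fibres {n = n} L P? ℓ w f c c∘ℓ≗f = begin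
  ∑[ k ∈ allFin n ] (∑[ a ∈ L ] 𝟙 (P? a ×-dec (ℓ a FinP.≟ k)) * w a) * c k
    ≡⟨ ∑-cong (allFin n) (λ k → *-distribʳ-∑ (c k) L _) ⟩
  ∑[ k ∈ allFin n ] ∑[ a ∈ L ] 𝟙 (P? a ×-dec (ℓ a FinP.≟ k)) * w a * c k
    ≡⟨ ∑-comm (allFin n) L _ ⟩
  ∑[ a ∈ L ] ∑[ k ∈ allFin n ] 𝟙 (P? a ×-dec (ℓ a FinP.≟ k)) * w a * c k
    ≡⟨ ∑-cong L fibre ⟩
  ∑[ a ∈ L ] 𝟙 (P? a) * w a * f a
    ∎
  where
  open ≡-Reasoning
  fibre : ∀ a → ∑[ k ∈ allFin n ] 𝟙 (P? a ×-dec (ℓ a FinP.≟ k)) * w a * c k ≡ 𝟙 (P? a) * w a * f a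
  fibre a with P? a
  ... | no _   = ∑-zero (allFin n)
  ... | yes Pa = begin
    ∑[ k ∈ allFin n ] 𝟙 (ℓ a FinP.≟ k) * w a * c k    ≡⟨ ∑-cong (allFin n) (λ k → *-assoc (𝟙 (ℓ a FinP.≟ k)) (w a) (c k)) ⟩
    ∑[ k ∈ allFin n ] 𝟙 (ℓ a FinP.≟ k) * (w a * c k)  ≡⟨ ∑-allFin-𝟙≟ (ℓ a) (λ k → w a * c k) ⟩
    w a * c (ℓ a)                                     ≡⟨ cong (w a *_) (c∘ℓ≗f a Pa) ⟩
    w a * f a                                         ≡⟨ cong (_* f a) (*-identityˡ (w a)) ⟨
    1 * w a * f a                                     ∎

module _ {v : ℕ} (P : PartitionSeq v) where
  open PartitionSeq P

  inPart : (x : ℕ) (i : Fin (nParts x)) (X : Subset v) → Dec (∣ X ∣ ≡ x × label x X ≡ i)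
  inPart x i X = (∣ X ∣ ≟ x) ×-dec (label x X FinP.≟ i)

  countUp≡∑ : (y : ℕ) (X : Subset v) (j : Fin (nParts y)) →
    countUp P y X j ≡ ∑[ Y ∈ allSubsets v ] 𝟙 (inPart y j Y) * 𝟙 (X ⊆? Y)
  countUp≡∑ y X j = trans (length-filter≡∑𝟙 _ (allSubsets v))
    (∑-cong (allSubsets v) (λ Y → 𝟙-×-assoc (∣ Y ∣ ≟ y) (label y Y FinP.≟ j) (X ⊆? Y)))

  countDown≡∑ : (x : ℕ) (i : Fin (nParts x)) (Y : Subset v) →
    countDown P x i Y ≡ ∑[ X ∈ allSubsets v ] 𝟙 (inPart x i X) * 𝟙 (X ⊆? Y)
  countDown≡∑ x i Y = trans (length-filter≡∑𝟙 _ (allSubsets v))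
    (∑-cong (allSubsets v) (λ X → 𝟙-×-assoc (∣ X ∣ ≟ x) (label x X FinP.≟ i) (X ⊆? Y)))

module _ {v : ℕ} (P : PartitionSeq v) (tactical : IsTactical P) where
  open PartitionSeq P

  countUp-rep : {x y : ℕ} → x ≤ y → y ≤ v → (x≤v : x ≤ v) (X : Subset v) → ∣ X ∣ ≡ x →
    (j : Fin (nParts y)) → countUp P y (rep x x≤v (label x X)) j ≡ countUp P y X j
  countUp-rep x≤y y≤v x≤v X ∣X∣≡x =
    proj₁ (tactical _ _ x≤y y≤v) _ X (rep-size _ x≤v _) ∣X∣≡x (rep-label _ x≤v _)

  countDown-rep : {x y : ℕ} → x ≤ y → (y≤v : y ≤ v) (Y : Subset v) → ∣ Y ∣ ≡ y →
    (i : Fin (nParts x)) → countDown P x i (rep y y≤v (label y Y)) ≡ countDown P x i Y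
  countDown-rep x≤y y≤v Y ∣Y∣≡y =
    proj₂ (tactical _ _ x≤y y≤v) _ Y (rep-size _ y≤v _) ∣Y∣≡y (rep-label _ y≤v _)

  KtR-formula : (x y z : ℕ) (x≤v : x ≤ v) (y≤v : y ≤ v) (z≤v : z ≤ v) → y ≤ x → y ≤ z →
    (X : Subset v) → ∣ X ∣ ≡ x → (j : Fin (nParts z)) →
    KtR P x y z x≤v y≤v z≤v (label x X) j ≡ sumOverPart P z j (λ Z → ∣ X ∩ Z ∣ C y)
  KtR-formula x y z x≤v y≤v z≤v y≤x y≤z X ∣X∣≡x j = begin
    ∑[ k ∈ allFin (nParts y) ] countDown P y k (rep x x≤v (label x X)) * countUp P z (rep y y≤v k) j
      ≡⟨ ∑-cong (allFin (nParts y)) (λ k → cong (_* countUp P z (rep y y≤v k) j)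
           (trans (countDown-rep y≤x x≤v X ∣X∣≡x k) (countDown≡∑ P y k X))) ⟩
    ∑[ k ∈ allFin (nParts y) ] (∑[ Y ∈ 𝒫 ] 𝟙 (inPart P y k Y) * 𝟙 (Y ⊆? X)) * countUp P z (rep y y≤v k) j
      ≡⟨ ∑-fibres 𝒫 (λ Y → ∣ Y ∣ ≟ y) (label y) (λ Y → 𝟙 (Y ⊆? X)) (λ Y → countUp P z Y j) _
           (λ Y ∣Y∣≡y → countUp-rep y≤z z≤v y≤v Y ∣Y∣≡y j) ⟩
    ∑[ Y ∈ 𝒫 ] 𝟙 (∣ Y ∣ ≟ y) * 𝟙 (Y ⊆? X) * countUp P z Y j
      ≡⟨ ∑-cong 𝒫 (λ Y → cong (𝟙 (∣ Y ∣ ≟ y) * 𝟙 (Y ⊆? X) *_) (countUp≡∑ P z Y j)) ⟩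
    ∑[ Y ∈ 𝒫 ] 𝟙 (∣ Y ∣ ≟ y) * 𝟙 (Y ⊆? X) * (∑[ Z ∈ 𝒫 ] 𝟙 (inPart P z j Z) * 𝟙 (Y ⊆? Z))
      ≡⟨ ∑-interchange 𝒫 𝒫 (λ Y → 𝟙 (∣ Y ∣ ≟ y) * 𝟙 (Y ⊆? X)) (λ Z → 𝟙 (inPart P z j Z)) (λ Y Z → 𝟙 (Y ⊆? Z)) ⟩
    ∑[ Z ∈ 𝒫 ] 𝟙 (inPart P z j Z) * (∑[ Y ∈ 𝒫 ] 𝟙 (∣ Y ∣ ≟ y) * 𝟙 (Y ⊆? X) * 𝟙 (Y ⊆? Z))
      ≡⟨ ∑-cong 𝒫 (λ Z → cong (𝟙 (inPart P z j Z) *_) (∑-common-subsets-of-size X Z y)) ⟩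
    ∑[ Z ∈ 𝒫 ] 𝟙 (inPart P z j Z) * (∣ X ∩ Z ∣ C y)
      ≡⟨ ∑-filter (inPart P z j) 𝒫 _ ⟨
    sumOverPart P z j (λ Z → ∣ X ∩ Z ∣ C y)
      ∎
    where
    open ≡-Reasoning
    𝒫 = allSubsets v

  RKt-formula : (x y z : ℕ) (x≤v : x ≤ v) (y≤v : y ≤ v) → x ≤ y → z ≤ y →
    (X : Subset v) → ∣ X ∣ ≡ x → (j : Fin (nParts z)) →
    RKt P x y z x≤v y≤v (label x X) j ≡ sumOverPart P z j (λ Z → (v ∸ ∣ X ∪ Z ∣) C (v ∸ y))
  RKt-formula x y z x≤v y≤v x≤y z≤y X ∣X∣≡x j = begin
    ∑[ k ∈ allFin (nParts y) ] countUp P y (rep x x≤v (label x X)) k * countDown P z j (rep y y≤v k)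
      ≡⟨ ∑-cong (allFin (nParts y)) (λ k → cong (_* countDown P z j (rep y y≤v k))
           (trans (countUp-rep x≤y y≤v x≤v X ∣X∣≡x k) (countUp≡∑ P y X k))) ⟩
    ∑[ k ∈ allFin (nParts y) ] (∑[ Y ∈ 𝒫 ] 𝟙 (inPart P y k Y) * 𝟙 (X ⊆? Y)) * countDown P z j (rep y y≤v k)
      ≡⟨ ∑-fibres 𝒫 (λ Y → ∣ Y ∣ ≟ y) (label y) (λ Y → 𝟙 (X ⊆? Y)) (countDown P z j) _
           (λ Y ∣Y∣≡y → countDown-rep z≤y y≤v Y ∣Y∣≡y j) ⟩
    ∑[ Y ∈ 𝒫 ] 𝟙 (∣ Y ∣ ≟ y) * 𝟙 (X ⊆? Y) * countDown P z j Y
      ≡⟨ ∑-cong 𝒫 (λ Y → cong (𝟙 (∣ Y ∣ ≟ y) * 𝟙 (X ⊆? Y) *_) (countDown≡∑ P z j Y)) ⟩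
    ∑[ Y ∈ 𝒫 ] 𝟙 (∣ Y ∣ ≟ y) * 𝟙 (X ⊆? Y) * (∑[ Z ∈ 𝒫 ] 𝟙 (inPart P z j Z) * 𝟙 (Z ⊆? Y))
      ≡⟨ ∑-interchange 𝒫 𝒫 (λ Y → 𝟙 (∣ Y ∣ ≟ y) * 𝟙 (X ⊆? Y)) (λ Z → 𝟙 (inPart P z j Z)) (λ Y Z → 𝟙 (Z ⊆? Y)) ⟩
    ∑[ Z ∈ 𝒫 ] 𝟙 (inPart P z j Z) * (∑[ Y ∈ 𝒫 ] 𝟙 (∣ Y ∣ ≟ y) * 𝟙 (X ⊆? Y) * 𝟙 (Z ⊆? Y))
      ≡⟨ ∑-cong 𝒫 (λ Z → cong (𝟙 (inPart P z j Z) *_) (∑-common-supersets-of-size X Z y≤v)) ⟩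
    ∑[ Z ∈ 𝒫 ] 𝟙 (inPart P z j Z) * ((v ∸ ∣ X ∪ Z ∣) C (v ∸ y))
      ≡⟨ ∑-filter (inPart P z j) 𝒫 _ ⟨
    sumOverPart P z j (λ Z → (v ∸ ∣ X ∪ Z ∣) C (v ∸ y))
      ∎
    where
    open ≡-Reasoning
    𝒫 = allSubsets v

lemma3p6 : (v : ℕ) (P : PartitionSeq v) → IsTactical P →
    (x y z : ℕ) (x≤v : x ≤ v) (y≤v : y ≤ v) (z≤v : z ≤ v) →
    (y ≤ x ⊓ z →
      (X : Subset v) → ∣ X ∣ ≡ x → (j : Fin (PartitionSeq.nParts P z)) →
        KtR P x y z x≤v y≤v z≤v (PartitionSeq.label P x X) j
          ≡ sumOverPart P z j (λ Z → ∣ X ∩ Z ∣ C y))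
    × (x ⊔ z ≤ y →
      (X : Subset v) → ∣ X ∣ ≡ x → (j : Fin (PartitionSeq.nParts P z)) →
        RKt P x y z x≤v y≤v (PartitionSeq.label P x X) j
          ≡ sumOverPart P z j (λ Z → (v ∸ ∣ X ∪ Z ∣) C (v ∸ y)))
lemma3p6 v P tactical x y z x≤v y≤v z≤v =
    (λ y≤x⊓z → KtR-formula P tactical x y z x≤v y≤v z≤v
                 (≤-trans y≤x⊓z (m⊓n≤m x z)) (≤-trans y≤x⊓z (m⊓n≤n x z)))
  , (λ x⊔z≤y → RKt-formula P tactical x y z x≤v y≤v
                 (≤-trans (m≤m⊔n x z) x⊔z≤y) (≤-trans (m≤n⊔m x z) x⊔z≤y))
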